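{- Let $T(x)=c_0+c_1x+\cdots+c_nx^n\in(\mathbb{Z}/2)[x]$ have degree $n\geq1$ and $c_0\neq0$. (1) The sequence $k\mapsto|A_1(k)\cap B_1(k)|$ is nonincreasing for $k\geq n$. (2) Suppose either $n$ is odd, or $n$ is even and $c_i\neq0$ for at least one $i$ with $0<i<n$. Then the sequence $k\mapsto|A_2(k)\cap B_2(k)|$ is nonincreasing for $k\geq n+1$. In particular, under these hypotheses the sizes $|A_1(k)\cap B_1(k)|$ and $|A_2(k)\cap B_2(k)|$ are independent of $k$ for all sufficiently large $k$.
   Context: Write $T(x)=c_0+\cdots+c_nx^n$ with $c_n\neq0$. The automaton $A_2(1;T)$ has line $r$ (for $r\geq0$) equal to $T(x)^r\in(\mathbb{Z}/2)[x]$. Each line is identified with the bi-infinite sequence $(a_j)_{j\in\mathbb{Z}}$ of its coefficients, with zeros outside the support. A string $w\in(\mathbb{Z}/2)^k$ is $k$-accessible if $w=(a_j,\dots,a_{j+k-1})$ for some line and some $j\in\mathbb{Z}$. Let $\mathscr{A}(k)$ be the set of $k$-accessible blocks. Define $A_1(k)=\{x_00x_10\cdots x_{k-1}0: x_0\cdots x_{k-1}\in\mathscr{A}(k)\}$ and $A_2(k)=\{0x_00x_1\cdots0x_{k-1}: x_0\cdots x_{k-1}\in\mathscr{A}(k)\}$, both subsets of $(\mathbb{Z}/2)^{2k}$. For $i\in\{1,2\}$ let $m_i(k)=k+\lfloor (n+i-1)/2\rfloor$. Define $T_{B_i}:(\mathbb{Z}/2)^{m_i(k)}\to(\mathbb{Z}/2)^{2k}$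 by $T_{B_i}(b)=(e_{n+i-1},\dots,e_{n+2k+i-2})$. Here $e_j$ is the coefficient of $x^j$ in $x\,T(x)\,b(x^2)$, where $b(x)=\sum_lb_lx^l$. Put $B_i(k)=T_{B_i}(\mathscr{A}(m_i(k)))$. -}

module Defs where

open import Data.Bool using (Bool; true; false; _xor_; if_then_else_)
open import Data.Nat using (ℕ; zero; suc; _+_; _∸_; _≤_; _<_; ⌊_/2⌋)
open import Data.Integer as ℤ using (ℤ; +_; -[1+_])
open import Data.Fin using (Fin; toℕ)
open import Data.List using (List; []; _∷_; length)
open import Data.List.Membership.Propositional using (_∈_)
open import Data.List.Relation.Unary.Unique.Propositional using (Unique)
open import Data.Vec using (Vec; []; _∷_; lookup; tabulate; toList)
open import Data.Product using (Σ; ∃; _×_; _,_)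
open import Relation.Binary.PropositionalEquality using (_≡_)

-- Polynomials over Z/2 as coefficient lists, lowest degree first (true = 1).
Poly : Set
Poly = List Bool

_⊕_ : Poly → Poly → Poly
[] ⊕ q = q
(a ∷ p) ⊕ [] = a ∷ p
(a ∷ p) ⊕ (b ∷ q) = (a xor b) ∷ (p ⊕ q)

zeros : Poly → Poly
zeros [] = []
zeros (_ ∷ q) = false ∷ zeros q

_⊗_ : Poly → Poly → Poly
[] ⊗ q = []
(a ∷ p) ⊗ q = (if a then q else zeros q) ⊕ (false ∷ (p ⊗ q))

one : Poly
one = true ∷ []

_^_ : Poly → ℕ → Poly
p ^ zero = one
p ^ suc r = p ⊗ (p ^ r)

coeffℕ : Poly → ℕ → Bool
coeffℕ [] _ = false
coeffℕ (a ∷ p) zero = a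
coeffℕ (a ∷ p) (suc m) = coeffℕ p m

-- coefficient at an integer position of the bi-infinite sequence
coeffℤ : Poly → ℤ → Bool
coeffℤ p (+ m) = coeffℕ p m
coeffℤ p -[1+ _ ] = false

spread : Poly → Poly
spread [] = []
spread (a ∷ p) = a ∷ false ∷ spread p

double : ℕ → ℕ
double zero = zero
double (suc k) = suc (suc (double k))

-- k-accessible blocks of the automaton A_2(1;T), T given by coefficient list
Accessible : Poly → (k : ℕ) → Vec Bool k → Set
Accessible T k w =
  ∃ λ (r : ℕ) → ∃ λ (j : ℤ) →
    (i : Fin k) → lookup w i ≡ coeffℤ (T ^ r) (j ℤ.+ + toℕ i)

interleave₁ : {k : ℕ} → Vec Bool k → Vec Bool (double k)
interleave₁ [] = []
interleave₁ (x ∷ xs) = x ∷ false ∷ interleave₁ xs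

interleave₂ : {k : ℕ} → Vec Bool k → Vec Bool (double k)
interleave₂ [] = []
interleave₂ (x ∷ xs) = false ∷ x ∷ interleave₂ xs

A₁ : Poly → (k : ℕ) → Vec Bool (double k) → Set
A₁ T k w = ∃ λ (x : Vec Bool k) → Accessible T k x × w ≡ interleave₁ x

A₂ : Poly → (k : ℕ) → Vec Bool (double k) → Set
A₂ T k w = ∃ λ (x : Vec Bool k) → Accessible T k x × w ≡ interleave₂ x

mᵢ : ℕ → ℕ → ℕ → ℕ
mᵢ n i k = k + ⌊ (n + i ∸ 1) /2⌋

TB : Poly → (n i k : ℕ) → Vec Bool (mᵢ n i k) → Vec Bool (double k)
TB T n i k b =
  tabulate λ (t : Fin (double k)) →
    coeffℕ ((false ∷ T) ⊗ spread (toList b)) (n + i ∸ 1 + toℕ t)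

B : Poly → (n i k : ℕ) → Vec Bool (double k) → Set
B T n i k w =
  ∃ λ (b : Vec Bool (mᵢ n i k)) → Accessible T (mᵢ n i k) b × w ≡ TB T n i k b

HasSize : {A : Set} → (A → Set) → ℕ → Set
HasSize {A} P m =
  Σ (List A) λ xs →
    Unique xs × ((a : A) → (P a → a ∈ xs) × (a ∈ xs → P a)) × length xs ≡ m

NonincreasingSizeFrom : ℕ → ((k : ℕ) → Vec Bool (double k) → Set) → Set
NonincreasingSizeFrom k₀ S =
  (k : ℕ) → k₀ ≤ k → (a b : ℕ) → HasSize (S k) a → HasSize (S (suc k)) b → b ≤ a

module Submission where

-- Dropping the first two letters maps the (k+1)-st set into the k-th one: subwords of
-- accessible blocks are accessible, and deleting the first letter of b shifts T_{B_i}(b)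
-- by two places, because the deleted term only reaches coefficients below the window.
-- This map is injective.  By Frobenius, T(x) · x T(x) b(x²) = x T(x²) b(x²) has no even
-- coefficients; since c_n = 1, this linear recurrence expresses each entry e_j with j + n
-- even through e_{j+1}, …, e_{j+n}.  Of the two dropped letters one is 0 by the shape of
-- A_i, and the other sits at such a j, with the n letters after it known once k ≥ n
-- (resp. k ≥ n + 1).

open import Defs
open import Algebra.Bundles using (CommutativeRing)
open import Data.Bool using (Bool; true; false; _xor_; _∧_; if_then_else_)
open import Data.Bool.Properties
  using (xor-assoc; xor-comm; xor-identityʳ; xor-same; ∧-zeroʳ; ∧-comm; ∧-distribˡ-xor; xor-∧-commutativeRing)
open import Data.Nat using (ℕ; zero; suc; _+_; _∸_; _≤_; _<_; _%_; z≤n; s≤s)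
open import Data.Nat.Properties
open import Data.Nat.Tactic.RingSolver using (solve-∀)
open import Data.Integer as ℤ using (+_)
import Data.Integer.Properties as ℤ
open import Data.Fin as Fin using (Fin; toℕ; fromℕ; fromℕ<) renaming (zero to fzero)
open import Data.Fin.Properties using (toℕ-fromℕ; toℕ-fromℕ<)
open import Data.List using (List; []; _∷_; length)
open import Data.List.Membership.Propositional using (_∈_)
open import Data.List.Relation.Unary.Any using (here; there)
import Data.List.Relation.Unary.All as All
open import Data.List.Relation.Unary.AllPairs using (_∷_)
open import Data.List.Relation.Unary.Unique.Propositional using (Unique)
open import Data.Vec using (Vec; []; _∷_; lookup; toList)
open import Data.Vec.Properties using (tabulate-cong; lookup∘tabulate)
open import Data.Product using (∃; _×_; _,_; proj₁; proj₂)
open import Data.Sum using (_⊎_)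
open import Data.Empty using (⊥-elim)
open import Relation.Binary.Definitions using (tri<; tri≈; tri>)
open import Relation.Binary.PropositionalEquality
open import Algebra.Properties.CommutativeSemigroup
  (CommutativeRing.+-commutativeSemigroup xor-∧-commutativeRing) using (interchange)
open import Algebra.Properties.CommutativeSemigroup
  (CommutativeRing.*-commutativeSemigroup xor-∧-commutativeRing) using (x∙yz≈y∙xz)

xor-cancelʳ : ∀ x {a b} → a xor x ≡ b xor x → a ≡ b
xor-cancelʳ x {a} {b} eq = begin
  a                  ≡⟨ sym (xor-identityʳ a) ⟩
  a xor false        ≡⟨ cong (a xor_) (sym (xor-same x)) ⟩
  a xor (x xor x)    ≡⟨ sym (xor-assoc a x x) ⟩
  (a xor x) xor x    ≡⟨ cong (_xor x) eq ⟩
  (b xor x) xor x    ≡⟨ xor-assoc b x x ⟩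
  b xor (x xor x)    ≡⟨ cong (b xor_) (xor-same x) ⟩
  b xor false        ≡⟨ xor-identityʳ b ⟩
  b                  ∎
  where open ≡-Reasoning

xor-cancelˡ : ∀ x {a b} → x xor a ≡ x xor b → a ≡ b
xor-cancelˡ x {a} {b} eq = xor-cancelʳ x (trans (xor-comm a x) (trans eq (xor-comm x b)))

-- Sum in ℤ/2 over the inclusive range 0 ≤ a ≤ m.
xorSum : ℕ → (ℕ → Bool) → Bool
xorSum zero    h = h 0
xorSum (suc m) h = h 0 xor xorSum m (λ a → h (suc a))

xorSum-cong : ∀ m {g h : ℕ → Bool} → (∀ a → a ≤ m → g a ≡ h a) → xorSum m g ≡ xorSum m h
xorSum-cong zero    eq = eq 0 z≤n
xorSum-cong (suc m) eq = cong₂ _xor_ (eq 0 z≤n) (xorSum-cong m (λ a a≤m → eq (suc a) (s≤s a≤m)))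

xorSum-suc : ∀ m h → xorSum (suc m) h ≡ xorSum m h xor h (suc m)
xorSum-suc zero    h = refl
xorSum-suc (suc m) h =
  trans (cong (h 0 xor_) (xorSum-suc m (λ a → h (suc a)))) (sym (xor-assoc (h 0) _ _))

xorSum-xor : ∀ m g h → xorSum m (λ a → g a xor h a) ≡ xorSum m g xor xorSum m h
xorSum-xor zero    g h = refl
xorSum-xor (suc m) g h =
  trans (cong ((g 0 xor h 0) xor_) (xorSum-xor m (λ a → g (suc a)) (λ a → h (suc a))))
        (interchange (g 0) (h 0) _ _)

xorSum-∧ˡ : ∀ m d h → xorSum m (λ a → d ∧ h a) ≡ d ∧ xorSum m h
xorSum-∧ˡ zero    d h = refl
xorSum-∧ˡ (suc m) d h =
  trans (cong ((d ∧ h 0) xor_) (xorSum-∧ˡ m d (λ a → h (suc a))))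
        (sym (∧-distribˡ-xor d (h 0) _))

xorSum-false : ∀ m → xorSum m (λ _ → false) ≡ false
xorSum-false m = xorSum-∧ˡ m false (λ _ → false)

xorSum-reverse : ∀ m h → xorSum m h ≡ xorSum m (λ a → h (m ∸ a))
xorSum-reverse zero    h = refl
xorSum-reverse (suc m) h = begin
    h 0 xor xorSum m (λ a → h (suc a))
  ≡⟨ cong (h 0 xor_) (xorSum-reverse m (λ a → h (suc a))) ⟩
    h 0 xor xorSum m (λ a → h (suc (m ∸ a)))
  ≡⟨ xor-comm (h 0) _ ⟩
    xorSum m (λ a → h (suc (m ∸ a))) xor h 0
  ≡⟨ cong₂ _xor_ (xorSum-cong m (λ a a≤m → cong h (sym (+-∸-assoc 1 a≤m))))
                 (cong h (sym (n∸n≡0 m))) ⟩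
    xorSum m (λ a → h (suc m ∸ a)) xor h (suc m ∸ suc m)
  ≡⟨ sym (xorSum-suc m (λ a → h (suc m ∸ a))) ⟩
    xorSum (suc m) (λ a → h (suc m ∸ a))
  ∎
  where open ≡-Reasoning

xorSum-determines : ∀ m n (g h : ℕ → Bool) → n ≤ m → xorSum m g ≡ xorSum m h →
                    (∀ s → s ≤ m → s ≢ n → g s ≡ h s) → g n ≡ h n
xorSum-determines zero    .zero   g h z≤n     eq agree = eq
xorSum-determines (suc m) zero    g h _       eq agree =
  xor-cancelʳ _ (trans eq (cong (h 0 xor_)
    (sym (xorSum-cong m (λ a a≤m → agree (suc a) (s≤s a≤m) (λ ()))))))
xorSum-determines (suc m) (suc n) g h (s≤s n≤m) eq agree =
  xorSum-determines m n (λ a → g (suc a)) (λ a → h (suc a)) n≤m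
    (xor-cancelˡ (h 0) (trans (cong (_xor xorSum m (λ a → g (suc a))) (sym g₀≡h₀)) eq))
    (λ s s≤m s≢n → agree (suc s) (s≤s s≤m) (λ eq → s≢n (suc-injective eq)))
  where
  g₀≡h₀ : g 0 ≡ h 0
  g₀≡h₀ = agree 0 z≤n (λ ())

-- Cauchy product of power series over ℤ/2; m ∸ a is exact since a ≤ m in the sum.
_⋆_ : (ℕ → Bool) → (ℕ → Bool) → ℕ → Bool
(f ⋆ g) m = xorSum m (λ a → f a ∧ g (m ∸ a))

shift : (ℕ → Bool) → ℕ → Bool
shift g zero    = false
shift g (suc m) = g m

⋆-comm : ∀ f g m → (f ⋆ g) m ≡ (g ⋆ f) m
⋆-comm f g m = trans (xorSum-reverse m _) (xorSum-cong m (λ a a≤m →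
  trans (cong (λ z → f (m ∸ a) ∧ g z) (m∸[m∸n]≡n a≤m)) (∧-comm (f (m ∸ a)) (g a))))

⋆-congʳ : ∀ f {g h} m → (∀ x → g x ≡ h x) → (f ⋆ g) m ≡ (f ⋆ h) m
⋆-congʳ f m eq = xorSum-cong m (λ a _ → cong (f a ∧_) (eq (m ∸ a)))

⋆-xorʳ : ∀ f g h m → (f ⋆ (λ x → g x xor h x)) m ≡ (f ⋆ g) m xor (f ⋆ h) m
⋆-xorʳ f g h m = trans (xorSum-cong m (λ a _ → ∧-distribˡ-xor (f a) _ _)) (xorSum-xor m _ _)

⋆-∧ʳ : ∀ f d g m → (f ⋆ (λ x → d ∧ g x)) m ≡ d ∧ (f ⋆ g) m
⋆-∧ʳ f d g m = trans (xorSum-cong m (λ a _ → x∙yz≈y∙xz (f a) d _)) (xorSum-∧ˡ m d _)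

⋆-zeroʳ : ∀ f m → (f ⋆ (λ _ → false)) m ≡ false
⋆-zeroʳ f m = trans (xorSum-cong m (λ a _ → ∧-zeroʳ (f a))) (xorSum-false m)

⋆-shiftʳ-zero : ∀ f g → (f ⋆ shift g) 0 ≡ false
⋆-shiftʳ-zero f g = ∧-zeroʳ (f 0)

⋆-shiftʳ-suc : ∀ f g m → (f ⋆ shift g) (suc m) ≡ (f ⋆ g) m
⋆-shiftʳ-suc f g m = trans (⋆-comm f (shift g) (suc m)) (⋆-comm g f m)

⋆-self-odd : ∀ f u → (f ⋆ f) (suc (double u)) ≡ false
⋆-self-odd f zero    = cancel (f 0) (f 1)
  where
  cancel : ∀ a b → (a ∧ b) xor (b ∧ a) ≡ false
  cancel a b = trans (cong ((a ∧ b) xor_) (∧-comm b a)) (xor-same (a ∧ b))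
⋆-self-odd f (suc u) = begin
    (f 0 ∧ F) xor xorSum (suc m) (λ a → f (suc a) ∧ f (suc m ∸ a))
  ≡⟨ cong ((f 0 ∧ F) xor_) (xorSum-suc m (λ a → f (suc a) ∧ f (suc m ∸ a))) ⟩
    (f 0 ∧ F) xor ((xorSum m (λ a → f (suc a) ∧ f (suc m ∸ a))) xor (F ∧ f (m ∸ m)))
  ≡⟨ cong₂ (λ x y → (f 0 ∧ F) xor (x xor (F ∧ f y)))
       (trans (xorSum-cong m (λ a a≤m → cong (λ z → f (suc a) ∧ f z) (+-∸-assoc 1 a≤m)))
              (⋆-self-odd (λ a → f (suc a)) u))
       (n∸n≡0 m) ⟩
    (f 0 ∧ F) xor (F ∧ f 0)
  ≡⟨ cong ((f 0 ∧ F) xor_) (∧-comm F (f 0)) ⟩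
    (f 0 ∧ F) xor (f 0 ∧ F)
  ≡⟨ xor-same (f 0 ∧ F) ⟩
    false
  ∎
  where
  open ≡-Reasoning
  m : ℕ
  m = suc (double u)
  F : Bool
  F = f (suc (suc m))

coeff-⊕ : ∀ p q m → coeffℕ (p ⊕ q) m ≡ coeffℕ p m xor coeffℕ q m
coeff-⊕ []      q       m       = refl
coeff-⊕ (a ∷ p) []      m       = sym (xor-identityʳ _)
coeff-⊕ (a ∷ p) (b ∷ q) zero    = refl
coeff-⊕ (a ∷ p) (b ∷ q) (suc m) = coeff-⊕ p q m

coeff-zeros : ∀ q m → coeffℕ (zeros q) m ≡ false
coeff-zeros []      m       = refl
coeff-zeros (x ∷ q) zero    = refl
coeff-zeros (x ∷ q) (suc m) = coeff-zeros q m

coeff-if : ∀ a q m → coeffℕ (if a then q else zeros q) m ≡ a ∧ coeffℕ q m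
coeff-if true  q m = refl
coeff-if false q m = coeff-zeros q m

coeff-⊗ : ∀ p q m → coeffℕ (p ⊗ q) m ≡ (coeffℕ p ⋆ coeffℕ q) m
coeff-⊗ []      q m       = sym (xorSum-false m)
coeff-⊗ (a ∷ p) q zero    =
  trans (coeff-⊕ (if a then q else zeros q) (false ∷ (p ⊗ q)) zero)
        (trans (xor-identityʳ _) (coeff-if a q zero))
coeff-⊗ (a ∷ p) q (suc m) =
  trans (coeff-⊕ (if a then q else zeros q) (false ∷ (p ⊗ q)) (suc m))
        (cong₂ _xor_ (coeff-if a q (suc m)) (coeff-⊗ p q m))

coeff-toList : ∀ {m} (v : Vec Bool m) (i : Fin m) → coeffℕ (toList v) (toℕ i) ≡ lookup v i
coeff-toList (x ∷ v) fzero      = refl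
coeff-toList (x ∷ v) (Fin.suc i) = coeff-toList v i

coeff-toList-beyond : ∀ {m} (v : Vec Bool m) s → m ≤ s → coeffℕ (toList v) s ≡ false
coeff-toList-beyond []      s       _         = refl
coeff-toList-beyond (x ∷ v) (suc s) (s≤s m≤s) = coeff-toList-beyond v s m≤s

module _ (T : Poly) where

  e : Poly → ℕ → Bool
  e D = coeffℕ ((false ∷ T) ⊗ spread D)

  e-⋆ : ∀ D m → e D m ≡ (coeffℕ (spread D) ⋆ coeffℕ (false ∷ T)) m
  e-⋆ D m = trans (coeff-⊗ (false ∷ T) (spread D) m) (⋆-comm (coeffℕ (false ∷ T)) (coeffℕ (spread D)) m)

  e-∷ : ∀ d D m → e (d ∷ D) m ≡ (d ∧ shift (coeffℕ T) m) xor shift (shift (e D)) m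
  e-∷ d D zero          = trans (e-⋆ (d ∷ D) 0) (sym (xor-identityʳ _))
  e-∷ d D (suc zero)    = e-⋆ (d ∷ D) 1
  e-∷ d D (suc (suc m)) =
    trans (e-⋆ (d ∷ D) (suc (suc m))) (cong ((d ∧ coeffℕ T (suc m)) xor_) (sym (e-⋆ D m)))

  -- T(x) · x T(x) D(x²) = x T(x²) D(x²) by Frobenius.
  e-even : ∀ D u → (coeffℕ T ⋆ e D) (double u) ≡ false
  e-even []      u = trans (⋆-congʳ f (double u) e-[]) (⋆-zeroʳ f (double u))
    where
    f : ℕ → Bool
    f = coeffℕ T
    e-[] : ∀ m → e [] m ≡ false
    e-[] m = trans (coeff-⊗ (false ∷ T) [] m) (⋆-zeroʳ (coeffℕ (false ∷ T)) m)
  e-even (d ∷ D) u = begin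
      (f ⋆ e (d ∷ D)) (double u)
    ≡⟨ ⋆-congʳ f (double u) (e-∷ d D) ⟩
      (f ⋆ (λ m → (d ∧ shift f m) xor shift (shift (e D)) m)) (double u)
    ≡⟨ ⋆-xorʳ f (λ m → d ∧ shift f m) (shift (shift (e D))) (double u) ⟩
      (f ⋆ (λ m → d ∧ shift f m)) (double u) xor (f ⋆ shift (shift (e D))) (double u)
    ≡⟨ cong₂ _xor_ (trans (⋆-∧ʳ f d (shift f) (double u)) (cong (d ∧_) (shift-self u)))
                   (shift-shift u) ⟩
      (d ∧ false) xor false
    ≡⟨ cong (_xor false) (∧-zeroʳ d) ⟩
      false
    ∎
    where
    open ≡-Reasoning
    f : ℕ → Bool
    f = coeffℕ T
    shift-self : ∀ u → (f ⋆ shift f) (double u) ≡ false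
    shift-self zero    = ⋆-shiftʳ-zero f f
    shift-self (suc u) = trans (⋆-shiftʳ-suc f f (suc (double u))) (⋆-self-odd f u)
    shift-shift : ∀ u → (f ⋆ shift (shift (e D))) (double u) ≡ false
    shift-shift zero    = ⋆-shiftʳ-zero f (shift (e D))
    shift-shift (suc u) = trans (⋆-shiftʳ-suc f (shift (e D)) (suc (double u)))
                                (trans (⋆-shiftʳ-suc f (e D) (double u)) (e-even D u))

drop2 : ∀ {k} → Vec Bool (double (suc k)) → Vec Bool (double k)
drop2 (_ ∷ _ ∷ w) = w

Accessible-tail : ∀ T {m} x (xs : Vec Bool m) → Accessible T (suc m) (x ∷ xs) → Accessible T m xs
Accessible-tail T x xs (r , j , at) = r , j ℤ.+ + 1 , λ i →
  trans (at (Fin.suc i)) (cong (coeffℤ (T ^ r)) (sym (ℤ.+-assoc j (+ 1) (+ toℕ i))))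

A₁-drop2 : ∀ T k {w} → A₁ T (suc k) w → A₁ T k (drop2 w)
A₁-drop2 T k (x ∷ xs , acc , refl) = xs , Accessible-tail T x xs acc , refl

A₂-drop2 : ∀ T k {w} → A₂ T (suc k) w → A₂ T k (drop2 w)
A₂-drop2 T k (x ∷ xs , acc , refl) = xs , Accessible-tail T x xs acc , refl

A₁-second≡false : ∀ {T k w₀ w₁ wr} → A₁ T (suc k) (w₀ ∷ w₁ ∷ wr) → w₁ ≡ false
A₁-second≡false (_ ∷ _ , _ , refl) = refl

A₂-first≡false : ∀ {T k w₀ w₁ wr} → A₂ T (suc k) (w₀ ∷ w₁ ∷ wr) → w₀ ≡ false
A₂-first≡false (_ ∷ _ , _ , refl) = refl

remove : ∀ {A : Set} {y : A} (xs : List A) → y ∈ xs → List A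
remove (x ∷ xs) (here _)  = xs
remove (x ∷ xs) (there p) = x ∷ remove xs p

length-remove : ∀ {A : Set} {y : A} (xs : List A) (p : y ∈ xs) → suc (length (remove xs p)) ≡ length xs
length-remove (x ∷ xs) (here _)  = refl
length-remove (x ∷ xs) (there p) = cong suc (length-remove xs p)

∈-remove : ∀ {A : Set} {y z : A} (xs : List A) (p : y ∈ xs) → z ∈ xs → z ≢ y → z ∈ remove xs p
∈-remove (x ∷ xs) (here refl) (here refl) z≢y = ⊥-elim (z≢y refl)
∈-remove (x ∷ xs) (here _)    (there q)   _   = q
∈-remove (x ∷ xs) (there p)   (here eq)   _   = here eq
∈-remove (x ∷ xs) (there p)   (there q)   z≢y = there (∈-remove xs p q z≢y)

length-≤-injection : ∀ {A B : Set} (g : A → B) (ys : List A) (xs : List B) → Unique ys →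
                     (∀ {y} → y ∈ ys → g y ∈ xs) →
                     (∀ {y y'} → y ∈ ys → y' ∈ ys → g y ≡ g y' → y ≡ y') →
                     length ys ≤ length xs
length-≤-injection g []       xs _                 _    _   = z≤n
length-≤-injection g (y ∷ ys) xs (y∉ys ∷ unique) into inj =
  subst (suc (length ys) ≤_) (length-remove xs gy∈xs)
    (s≤s (length-≤-injection g ys (remove xs gy∈xs) unique into′ (λ p q → inj (there p) (there q))))
  where
  gy∈xs : g y ∈ xs
  gy∈xs = into (here refl)
  into′ : ∀ {y'} → y' ∈ ys → g y' ∈ remove xs gy∈xs
  into′ q = ∈-remove xs gy∈xs (into (there q))
    (λ eq → All.lookup y∉ys q (inj (here refl) (there q) (sym eq)))

nonincreasing-by-injection :
  ∀ k₀ (S : (k : ℕ) → Vec Bool (double k) → Set)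
  (ρ : ∀ {k} → Vec Bool (double (suc k)) → Vec Bool (double k)) →
  (∀ k → k₀ ≤ k → ∀ {w} → S (suc k) w → S k (ρ w)) →
  (∀ k → k₀ ≤ k → ∀ {w w'} → S (suc k) w → S (suc k) w' → ρ w ≡ ρ w' → w ≡ w') →
  NonincreasingSizeFrom k₀ S
nonincreasing-by-injection k₀ S ρ into inj k k₀≤k a b
  (xs , _ , enum-xs , |xs|≡a) (ys , unique-ys , enum-ys , |ys|≡b) =
  subst₂ _≤_ |ys|≡b |xs|≡a
    (length-≤-injection ρ ys xs unique-ys
      (λ p → proj₁ (enum-xs _) (into k k₀≤k (member p)))
      (λ p q → inj k k₀≤k (member p) (member q)))
  where
  member : ∀ {w} → w ∈ ys → S (suc k) w
  member {w} = proj₂ (enum-ys w)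

double-+ : ∀ u → double u ≡ u + u
double-+ zero    = refl
double-+ (suc u) = cong suc (trans (cong suc (double-+ u)) (sym (+-suc u u)))

≤-double : ∀ k → k ≤ double k
≤-double zero    = z≤n
≤-double (suc k) = s≤s (m≤n⇒m≤1+n (≤-double k))

module OfDegree (T : Poly) (n : ℕ) (Tₙ≡1 : coeffℕ T n ≡ true)
                (T-vanishes : ∀ s → n < s → coeffℕ T s ≡ false) where

  e-∷-beyond : ∀ d D m → n ≤ m → e T (d ∷ D) (suc (suc m)) ≡ e T D m
  e-∷-beyond d D m n≤m = begin
      e T (d ∷ D) (suc (suc m))
    ≡⟨ e-∷ T d D (suc (suc m)) ⟩
      (d ∧ coeffℕ T (suc m)) xor e T D m
    ≡⟨ cong (λ z → (d ∧ z) xor e T D m) (T-vanishes (suc m) (s≤s n≤m)) ⟩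
      (d ∧ false) xor e T D m
    ≡⟨ cong (_xor e T D m) (∧-zeroʳ d) ⟩
      e T D m
    ∎
    where open ≡-Reasoning

  -- The coefficient of x^(j+n) in T(x) · x T(x) D(x²) is ∑ₛ cₛ e_{j+n-s} = 0, and only
  -- the term s = n involves e_j, with cₙ = 1.
  e-determined : ∀ D D' j u → j + n ≡ double u →
                 (∀ v → 1 ≤ v → v ≤ n → e T D (j + v) ≡ e T D' (j + v)) → e T D j ≡ e T D' j
  e-determined D D' j u j+n≡2u agree =
    subst (λ m → e T D m ≡ e T D' m) (m+n∸n≡m j n)
      (subst (λ b → b ∧ e T D (j + n ∸ n) ≡ b ∧ e T D' (j + n ∸ n)) Tₙ≡1
        (xorSum-determines (j + n) n (term D) (term D') (m≤n+m n j)
          (trans (vanishes D) (sym (vanishes D'))) agree-off-n))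
    where
    term : Poly → ℕ → Bool
    term X s = coeffℕ T s ∧ e T X (j + n ∸ s)
    vanishes : ∀ X → xorSum (j + n) (term X) ≡ false
    vanishes X = subst (λ m → (coeffℕ T ⋆ e T X) m ≡ false) (sym j+n≡2u) (e-even T X u)
    agree-off-n : ∀ s → s ≤ j + n → s ≢ n → term D s ≡ term D' s
    agree-off-n s _ s≢n with <-cmp s n
    ... | tri< s<n _ _ = cong (coeffℕ T s ∧_)
          (subst (λ m → e T D m ≡ e T D' m) (sym (+-∸-assoc j (<⇒≤ s<n)))
            (agree (n ∸ s) (m<n⇒0<n∸m s<n) (m∸n≤m n s)))
    ... | tri≈ _ s≡n _ = ⊥-elim (s≢n s≡n)
    ... | tri> _ _ n<s = trans (cong (_∧ e T D (j + n ∸ s)) (T-vanishes s n<s))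
                               (cong (_∧ e T D' (j + n ∸ s)) (sym (T-vanishes s n<s)))

  TB-drop2 : ∀ i k b₀ (b : Vec Bool (mᵢ n i k)) → n ≤ n + i ∸ 1 →
             drop2 (TB T n i (suc k) (b₀ ∷ b)) ≡ TB T n i k b
  TB-drop2 i k b₀ b n≤base = tabulate-cong λ t →
    trans (cong (e T (b₀ ∷ toList b)) (trans (+-suc base (suc (toℕ t))) (cong suc (+-suc base (toℕ t)))))
          (e-∷-beyond b₀ (toList b) (base + toℕ t) (≤-trans n≤base (m≤m+n base (toℕ t))))
    where
    base : ℕ
    base = n + i ∸ 1

  B-drop2 : ∀ i k {w} → n ≤ n + i ∸ 1 → B T n i (suc k) w → B T n i k (drop2 w)
  B-drop2 i k n≤base (b₀ ∷ b , acc , refl) = b , Accessible-tail T b₀ b acc , TB-drop2 i k b₀ b n≤base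

  TB-head : ∀ i k (b : Vec Bool (mᵢ n i (suc k))) {w₀ w₁ wr} → w₀ ∷ w₁ ∷ wr ≡ TB T n i (suc k) b →
            w₀ ≡ e T (toList b) (n + i ∸ 1 + 0) × w₁ ≡ e T (toList b) (n + i ∸ 1 + 1)
  TB-head i k b refl = refl , refl

  TB-tail : ∀ i k (b : Vec Bool (mᵢ n i (suc k))) {w₀ w₁ wr} → w₀ ∷ w₁ ∷ wr ≡ TB T n i (suc k) b →
            ∀ q (q<2k : q < double k) → lookup wr (fromℕ< q<2k) ≡ e T (toList b) (n + i ∸ 1 + (2 + q))
  TB-tail i k b refl q q<2k = trans (lookup∘tabulate _ (fromℕ< q<2k))
    (cong (λ z → e T (toList b) (n + i ∸ 1 + (2 + z))) (toℕ-fromℕ< q<2k))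

  A₁∩B₁ : (k : ℕ) → Vec Bool (double k) → Set
  A₁∩B₁ k w = A₁ T k w × B T n 1 k w

  A₂∩B₂ : (k : ℕ) → Vec Bool (double k) → Set
  A₂∩B₂ k w = A₂ T k w × B T n 2 k w

  A₁∩B₁-drop2 : ∀ k → n ≤ k → ∀ {w} → A₁∩B₁ (suc k) w → A₁∩B₁ k (drop2 w)
  A₁∩B₁-drop2 k _ (a , b) = A₁-drop2 T k a , B-drop2 1 k (≤-reflexive (sym (m+n∸n≡m n 1))) b

  A₂∩B₂-drop2 : ∀ k → suc n ≤ k → ∀ {w} → A₂∩B₂ (suc k) w → A₂∩B₂ k (drop2 w)
  A₂∩B₂-drop2 k _ (a , b) =
    A₂-drop2 T k a , B-drop2 2 k (≤-trans (m≤m+n n 1) (≤-reflexive (sym (+-∸-assoc n (s≤s z≤n))))) b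

  A₁∩B₁-drop2-injective : ∀ k → n ≤ k → ∀ {w w'} → A₁∩B₁ (suc k) w → A₁∩B₁ (suc k) w' →
                          drop2 w ≡ drop2 w' → w ≡ w'
  A₁∩B₁-drop2-injective k n≤k {w₀ ∷ w₁ ∷ wr} {w₀' ∷ w₁' ∷ .wr} (a , b , _ , β) (a' , b' , _ , β') refl =
    cong₂ (λ x y → x ∷ y ∷ wr) w₀≡w₀' w₁≡w₁'
    where
    base : ℕ
    base = n + 1 ∸ 1
    w₁≡w₁' : w₁ ≡ w₁'
    w₁≡w₁' = trans (A₁-second≡false a) (sym (A₁-second≡false a'))
    agree : ∀ v → 1 ≤ v → v ≤ n → e T (toList b) (base + v) ≡ e T (toList b') (base + v)
    agree (suc zero)    _ _   = trans (sym (proj₂ (TB-head 1 k b β))) (trans w₁≡w₁' (proj₂ (TB-head 1 k b' β')))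
    agree (suc (suc q)) _ v≤n = trans (sym (TB-tail 1 k b β q q<2k)) (TB-tail 1 k b' β' q q<2k)
      where
      q<2k : q < double k
      q<2k = ≤-trans (n≤1+n (suc q)) (≤-trans v≤n (≤-trans n≤k (≤-double k)))
    parity : base + 0 + n ≡ double n
    parity = trans (cong (_+ n) (trans (+-identityʳ base) (m+n∸n≡m n 1))) (sym (double-+ n))
    w₀≡w₀' : w₀ ≡ w₀'
    w₀≡w₀' = trans (proj₁ (TB-head 1 k b β))
      (trans (e-determined (toList b) (toList b') (base + 0) n parity
               (λ v 1≤v v≤n → subst (λ m → e T (toList b) m ≡ e T (toList b') m) (sym (+-assoc base 0 v))
                                     (agree v 1≤v v≤n)))
             (sym (proj₁ (TB-head 1 k b' β'))))

  A₂∩B₂-drop2-injective : ∀ k → suc n ≤ k → ∀ {w w'} → A₂∩B₂ (suc k) w → A₂∩B₂ (suc k) w' →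
                          drop2 w ≡ drop2 w' → w ≡ w'
  A₂∩B₂-drop2-injective k n<k {w₀ ∷ w₁ ∷ wr} {w₀' ∷ w₁' ∷ .wr} (a , b , _ , β) (a' , b' , _ , β') refl =
    cong₂ (λ x y → x ∷ y ∷ wr) w₀≡w₀' w₁≡w₁'
    where
    base : ℕ
    base = n + 2 ∸ 1
    w₀≡w₀' : w₀ ≡ w₀'
    w₀≡w₀' = trans (A₂-first≡false a) (sym (A₂-first≡false a'))
    agree : ∀ v → 1 ≤ v → v ≤ n → e T (toList b) (base + 1 + v) ≡ e T (toList b') (base + 1 + v)
    agree (suc q) _ v≤n = subst (λ m → e T (toList b) m ≡ e T (toList b') m) (sym (+-assoc base 1 (suc q)))
      (trans (sym (TB-tail 2 k b β q q<2k)) (TB-tail 2 k b' β' q q<2k))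
      where
      q<2k : q < double k
      q<2k = ≤-trans v≤n (≤-trans (n≤1+n n) (≤-trans n<k (≤-double k)))
    parity : base + 1 + n ≡ double (suc n)
    parity = begin
      n + 2 ∸ 1 + 1 + n  ≡⟨ cong (λ m → m + 1 + n) (+-∸-assoc n (s≤s z≤n)) ⟩
      n + 1 + 1 + n      ≡⟨ rearrange n ⟩
      suc n + suc n      ≡⟨ sym (double-+ (suc n)) ⟩
      double (suc n)     ∎
      where
      open ≡-Reasoning
      rearrange : ∀ m → m + 1 + 1 + m ≡ suc m + suc m
      rearrange = solve-∀
    w₁≡w₁' : w₁ ≡ w₁'
    w₁≡w₁' = trans (proj₂ (TB-head 2 k b β))
      (trans (e-determined (toList b) (toList b') (base + 1) (suc n) parity agree)
             (sym (proj₂ (TB-head 2 k b' β'))))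

mainTheorem7 :
    (n : ℕ) (c : Vec Bool (suc n)) →
    1 ≤ n → lookup c (fromℕ n) ≡ true → lookup c fzero ≡ true →
    NonincreasingSizeFrom n (λ k w → A₁ (toList c) k w × B (toList c) n 1 k w)
    × ((n % 2 ≡ 1
        ⊎ (n % 2 ≡ 0 × ∃ λ (i : Fin (suc n)) → 0 < toℕ i × toℕ i < n × lookup c i ≡ true))
       → NonincreasingSizeFrom (suc n) (λ k w → A₂ (toList c) k w × B (toList c) n 2 k w))
mainTheorem7 n c _ cₙ≡1 _ =
    nonincreasing-by-injection n A₁∩B₁ drop2 A₁∩B₁-drop2 A₁∩B₁-drop2-injective
  , λ _ → nonincreasing-by-injection (suc n) A₂∩B₂ drop2 A₂∩B₂-drop2 A₂∩B₂-drop2-injective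
  where
  Tₙ≡1 : coeffℕ (toList c) n ≡ true
  Tₙ≡1 = trans (cong (coeffℕ (toList c)) (sym (toℕ-fromℕ n))) (trans (coeff-toList c (fromℕ n)) cₙ≡1)
  open OfDegree (toList c) n Tₙ≡1 (coeff-toList-beyond c)
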